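{- Let $k\geq 3$ and let $(x_n)_{n\geq 0}$ be a sequence of integers satisfying $x_n=b_1x_{n-1}+b_2x_{n-2}+\dots+b_kx_{n-k}$ for all integers $n\geq k$, where $b_1,\dots,b_k\in\mathbb{Z}$, $b_k\neq 0$, with initial values $x_0=x_1=\dots=x_{k-2}=0$, $x_{k-1}=1$. Suppose that the characteristic polynomial $x^k-b_1x^{k-1}-\dots-b_k$ equals $(x-a_1)^2(x-a_2)(x-a_3)\cdots(x-a_{k-1})$, where $a_i\in\mathbb{Z}$ and $a_i\neq a_j$ for $1\leq i\neq j\leq k-1$. Let $p$ be a prime with $p\nmid a_1a_2\cdots a_{k-1}$. If $a_i\not\equiv a_j\pmod p$ for all $i\neq j$, then the quotient set of $(x_n)_{n\geq 0}$ is dense in $\mathbb{Q}_p$.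
   Context: The quotient set (ratio set) of a sequence $(x_n)_{n\ge0}$ of integers is $\{x_m/x_n : m,n\geq 0,\ x_n\neq 0\}$. $\mathbb{Q}_p$ denotes the field of $p$-adic numbers with the $p$-adic topology. -}

module Defs where

open import Data.Nat as ℕ using (ℕ; zero; suc; _∸_)
open import Data.Integer using (ℤ; +_; _+_; _*_; -_; _-_; _^_)
open import Data.Integer.Divisibility using (_∣_)
open import Data.Product using (Σ; _×_)
open import Relation.Nullary using (¬_)
open import Relation.Binary.PropositionalEquality using (_≡_)
open import Data.List using (List; []; _∷_; map; foldr; upTo; _++_)

sumTo : (ℕ → ℤ) → ℕ → ℤ
sumTo f zero    = + 0
sumTo f (suc n) = sumTo f n + f (suc n)

prodTo : (ℕ → ℤ) → ℕ → ℤ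
prodTo f zero    = + 1
prodTo f (suc n) = prodTo f n * f (suc n)

-- Polynomials over ℤ as coefficient lists, lowest degree first.
Poly : Set
Poly = List ℤ

padd : Poly → Poly → Poly
padd []       q        = q
padd (c ∷ p)  []       = c ∷ p
padd (c ∷ p)  (d ∷ q)  = (c + d) ∷ padd p q

pmul : Poly → Poly → Poly
pmul []      q = []
pmul (c ∷ p) q = padd (map (c *_) q) (+ 0 ∷ pmul p q)

linear : ℤ → Poly
linear a = (- a) ∷ (+ 1) ∷ []

-- x^k - b_1 x^{k-1} - ... - b_k  (coefficient of x^j is -b_{k-j} for j<k, and 1 for j=k)
charPoly : (ℕ → ℤ) → ℕ → Poly
charPoly b k = map (λ j → - b (k ∸ j)) (upTo k) ++ (+ 1 ∷ [])

factoredPoly : (ℕ → ℤ) → ℕ → Poly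
factoredPoly a k =
  pmul (linear (a 1))
       (foldr pmul (+ 1 ∷ []) (map (λ i → linear (a (suc i))) (upTo (k ∸ 1))))

-- p-adic closeness of the rationals u/v and r/s (v, s ≠ 0):
-- |u/v - r/s|_p ≤ p^{-N}, i.e. v_p(u s - r v) ≥ v_p(v s) + N.
-- Phrased without a valuation function: every power of p dividing v s,
-- multiplied by p^N, divides u s - r v.
PAdicClose : ℕ → ℕ → ℤ → ℤ → ℤ → ℤ → Set
PAdicClose p N u v r s =
  ∀ (e : ℕ) → ((+ p) ^ e) ∣ (v * s) → ((+ p) ^ (e ℕ.+ N)) ∣ (u * s - r * v)

-- The quotient set {x_m / x_n : x_n ≠ 0} of x is dense in ℚ_p.
-- Since ℚ is dense in ℚ_p, this means: every rational r/s is approximated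
-- p-adically to arbitrary precision p^{-N} by some quotient x_m / x_n.
QuotientSetDenseInQp : ℕ → (ℕ → ℤ) → Set
QuotientSetDenseInQp p x =
  ∀ (r s : ℤ) → ¬ (s ≡ + 0) → ∀ (N : ℕ) →
    Σ ℕ λ m → Σ ℕ λ n → ¬ (x n ≡ + 0) × PAdicClose p N (x m) (x n) r s

-- Let X act on sequences as the shift. Applying ∏ᵢ≥₂ (X - aᵢ) to x gives a sequence Y killed by
-- (X - a₁)² with Y 0 = 0, Y 1 = 1, so a₁ Yₙ = n a₁ⁿ. Undoing the factors X - aᵢ one at a time,
-- which only divides by differences of roots (units at p), gives D xₙ = (c + d n) a₁ⁿ + Σ eᵢ aᵢⁿ
-- with D, d prime to p. For N = (p - 1)! every aᵢᴺ ≡ 1 (mod p), so when t moves by l pʲ the value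
-- D x_{N t} moves by l pʲ d N modulo pʲ⁺¹; as d N is a unit, lifting digit by digit makes x_{N t}
-- hit every residue class modulo every pᴹ. Taking xₙ ≡ s and xₘ ≡ r (mod pᴹ) with M large then
-- makes xₘ / xₙ as p-adically close to r / s as required.

module Submission where

open import Defs
open import Data.Nat as ℕ using (ℕ; zero; suc; _≤_; _<_; _∸_; z≤n; s≤s; _!)
import Data.Nat.Properties as ℕₚ
import Data.Nat.Divisibility as ℕ∣
open import Data.Nat.Primality using (Prime; euclidsLemma; prime⇒nonTrivial)
open import Data.Integer as ℤ using (ℤ; +_; _+_; _*_; -_; _-_; _^_; ∣_∣; _%ℕ_; _/ℕ_)
import Data.Integer.Properties as ℤₚ
open import Data.Integer.DivMod using (a≡a%ℕn+[a/ℕn]*n; n%ℕd<d)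
open import Data.Integer.Divisibility using (_∣_)
open import Data.Integer.Divisibility.Signed
  using (divides; ∣ᵤ⇒∣; ∣⇒∣ᵤ; ∣-refl; ∣-trans; ∣m∣n⇒∣m+n; ∣m∣n⇒∣m-n; ∣n⇒∣m*n; ∣m⇒∣m*n;
         *-monoʳ-∣; *-cancelʳ-∣; module ∣-Reasoning)
  renaming (_∣_ to _∣ₛ_)
open import Data.Integer.Tactic.RingSolver using (solve-∀)
open import Data.Fin using (Fin; toℕ; fromℕ<)
open import Data.Fin.Properties using (pigeonhole; toℕ-fromℕ<; toℕ<n)
open import Data.List using (List; []; _∷_; _++_; map; foldr; length; applyUpTo)
import Data.List.Properties as Listₚ
open import Data.List.Relation.Unary.All as All using (All; []; _∷_)
import Data.List.Relation.Unary.All.Properties as Allₚ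
open import Data.List.Relation.Unary.AllPairs using (AllPairs; []; _∷_)
import Data.List.Relation.Unary.AllPairs.Properties as AllPairsₚ
open import Data.Product using (Σ; _×_; _,_; proj₁; proj₂; map₁)
open import Data.Sum using (_⊎_; inj₁; inj₂; [_,_]′)
open import Data.Empty using (⊥-elim)
open import Function using (_∘_; id)
open import Relation.Nullary using (¬_; yes; no)
open import Relation.Binary.PropositionalEquality
  using (_≡_; _≢_; refl; sym; trans; cong; cong₂; subst; subst₂; module ≡-Reasoning)

sumBelow : (ℕ → ℤ) → ℕ → ℤ
sumBelow f zero    = + 0
sumBelow f (suc k) = f 0 + sumBelow (f ∘ suc) k

sumBelow-cong : ∀ {f g} k → (∀ j → j < k → f j ≡ g j) → sumBelow f k ≡ sumBelow g k
sumBelow-cong zero    f≗g = refl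
sumBelow-cong (suc k) f≗g = cong₂ _+_ (f≗g 0 (s≤s z≤n)) (sumBelow-cong k (λ j j<k → f≗g (suc j) (s≤s j<k)))

sumBelow-neg : ∀ f k → sumBelow (-_ ∘ f) k ≡ - sumBelow f k
sumBelow-neg f zero    = refl
sumBelow-neg f (suc k) = trans (cong (_+_ (- f 0)) (sumBelow-neg (f ∘ suc) k)) (sym (ℤₚ.neg-distrib-+ (f 0) _))

sumBelow-reverse : ∀ f k → sumBelow (λ j → f (k ∸ j)) k ≡ sumTo f k
sumBelow-reverse f zero    = refl
sumBelow-reverse f (suc k) = trans (cong (_+_ (f (suc k))) (sumBelow-reverse f k)) (ℤₚ.+-comm (f (suc k)) (sumTo f k))

act : Poly → (ℕ → ℤ) → ℕ → ℤ
act []      g n = + 0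
act (c ∷ q) g n = c * g n + act q g (suc n)

act-cong : ∀ q {g g′} → (∀ n → g n ≡ g′ n) → ∀ n → act q g n ≡ act q g′ n
act-cong []      g≗g′ n = refl
act-cong (c ∷ q) g≗g′ n = cong₂ (λ u v → c * u + v) (g≗g′ n) (act-cong q g≗g′ (suc n))

act-one : ∀ g n → act (+ 1 ∷ []) g n ≡ g n
act-one g n = trans (ℤₚ.+-identityʳ _) (ℤₚ.*-identityˡ _)

act-linear : ∀ a g n → act (linear a) g n ≡ g (suc n) - a * g n
act-linear a g n = lemma a (g n) (g (suc n))
  where
  lemma : ∀ a x y → - a * x + (+ 1 * y + + 0) ≡ y - a * x
  lemma = solve-∀

act-padd : ∀ q r g n → act (padd q r) g n ≡ act q g n + act r g n
act-padd []      r       g n = sym (ℤₚ.+-identityˡ _)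
act-padd (c ∷ q) []      g n = sym (ℤₚ.+-identityʳ _)
act-padd (c ∷ q) (d ∷ r) g n =
  trans (cong (_+_ ((c + d) * g n)) (act-padd q r g (suc n))) (lemma c d (g n) _ _)
  where
  lemma : ∀ c d x y z → (c + d) * x + (y + z) ≡ c * x + y + (d * x + z)
  lemma = solve-∀

act-scale : ∀ c q g n → act (map (c *_) q) g n ≡ c * act q g n
act-scale c []      g n = sym (ℤₚ.*-zeroʳ c)
act-scale c (d ∷ q) g n =
  trans (cong (_+_ (c * d * g n)) (act-scale c q g (suc n))) (lemma c d (g n) _)
  where
  lemma : ∀ c d x y → c * d * x + c * y ≡ c * (d * x + y)
  lemma = solve-∀

act-pmul : ∀ q r g n → act (pmul q r) g n ≡ act q (act r g) n
act-pmul []      r g n = refl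
act-pmul (c ∷ q) r g n = begin
  act (padd (map (c *_) r) (+ 0 ∷ pmul q r)) g n
    ≡⟨ act-padd (map (c *_) r) (+ 0 ∷ pmul q r) g n ⟩
  act (map (c *_) r) g n + (+ 0 * g n + act (pmul q r) g (suc n))
    ≡⟨ cong₂ (λ u v → u + (+ 0 * g n + v)) (act-scale c r g n) (act-pmul q r g (suc n)) ⟩
  c * act r g n + (+ 0 * g n + act q (act r g) (suc n))
    ≡⟨ cong (_+_ (c * act r g n)) (ℤₚ.+-identityˡ _) ⟩
  c * act r g n + act q (act r g) (suc n) ∎
  where open ≡-Reasoning

act-++ : ∀ q r g n → act (q ++ r) g n ≡ act q g n + act r g (length q ℕ.+ n)
act-++ []      r g n = sym (ℤₚ.+-identityˡ _)
act-++ (c ∷ q) r g n =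
  trans (cong (_+_ (c * g n)) (act-++ q r g (suc n)))
        (trans (sym (ℤₚ.+-assoc (c * g n) _ _)) (cong (λ m → c * g n + act q g (suc n) + act r g m) (ℕₚ.+-suc (length q) n)))

act-applyUpTo : ∀ f k g n → act (applyUpTo f k) g n ≡ sumBelow (λ j → f j * g (j ℕ.+ n)) k
act-applyUpTo f zero    g n = refl
act-applyUpTo f (suc k) g n = cong (_+_ (f 0 * g n)) (trans (act-applyUpTo (f ∘ suc) k g (suc n))
  (sumBelow-cong k (λ j _ → cong (λ m → f (suc j) * g m) (ℕₚ.+-suc j n))))

act-charPoly : ∀ k b x → (∀ n → k ≤ n → x n ≡ sumTo (λ i → b i * x (n ∸ i)) k) →
               ∀ n → act (charPoly b k) x n ≡ + 0
act-charPoly k b x rec n = begin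
  act (charPoly b k) x n
    ≡⟨ cong (λ q → act (q ++ + 1 ∷ []) x n) (Listₚ.map-upTo h k) ⟩
  act (applyUpTo h k ++ + 1 ∷ []) x n
    ≡⟨ act-++ (applyUpTo h k) (+ 1 ∷ []) x n ⟩
  act (applyUpTo h k) x n + act (+ 1 ∷ []) x (length (applyUpTo h k) ℕ.+ n)
    ≡⟨ cong₂ _+_ (act-applyUpTo h k x n)
                 (trans (act-one x _) (cong (λ m → x (m ℕ.+ n)) (Listₚ.length-applyUpTo h k))) ⟩
  sumBelow (λ j → h j * x (j ℕ.+ n)) k + x (k ℕ.+ n)
    ≡⟨ cong (_+ x (k ℕ.+ n)) lower-terms ⟩
  - x (k ℕ.+ n) + x (k ℕ.+ n)
    ≡⟨ ℤₚ.+-inverseˡ (x (k ℕ.+ n)) ⟩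
  + 0 ∎
  where
  open ≡-Reasoning
  h G : ℕ → ℤ
  h j = - b (k ∸ j)
  G i = b i * x (k ℕ.+ n ∸ i)
  index : ∀ j → j ≤ k → k ℕ.+ n ∸ (k ∸ j) ≡ j ℕ.+ n
  index j j≤k = trans (ℕₚ.+-∸-comm n (ℕₚ.m∸n≤m k j)) (cong (ℕ._+ n) (ℕₚ.m∸[m∸n]≡n j≤k))
  lower-terms : sumBelow (λ j → h j * x (j ℕ.+ n)) k ≡ - x (k ℕ.+ n)
  lower-terms = begin
    sumBelow (λ j → h j * x (j ℕ.+ n)) k
      ≡⟨ sumBelow-cong k (λ j j<k → trans (sym (ℤₚ.neg-distribˡ-* (b (k ∸ j)) (x (j ℕ.+ n))))
                                          (cong (λ m → - (b (k ∸ j) * x m)) (sym (index j (ℕₚ.<⇒≤ j<k))))) ⟩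
    sumBelow (λ j → - G (k ∸ j)) k ≡⟨ sumBelow-neg (λ j → G (k ∸ j)) k ⟩
    - sumBelow (λ j → G (k ∸ j)) k ≡⟨ cong -_ (sumBelow-reverse G k) ⟩
    - sumTo G k                    ≡⟨ cong -_ (sym (rec (k ℕ.+ n) (ℕₚ.m≤m+n k n))) ⟩
    - x (k ℕ.+ n)                  ∎

prodLinear : List ℤ → Poly
prodLinear hs = foldr pmul (+ 1 ∷ []) (map linear hs)

act-prodLinear-∷ : ∀ h hs g n →
  act (prodLinear (h ∷ hs)) g n ≡ act (prodLinear hs) g (suc n) - h * act (prodLinear hs) g n
act-prodLinear-∷ h hs g n = trans (act-pmul (linear h) (prodLinear hs) g n) (act-linear h (act (prodLinear hs) g) n)

factoredPoly≡ : ∀ a m →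
  factoredPoly a (2 ℕ.+ m) ≡ pmul (linear (a 1)) (pmul (linear (a 1)) (prodLinear (applyUpTo (λ i → a (2 ℕ.+ i)) m)))
factoredPoly≡ a m = cong (λ l → pmul (linear (a 1)) (foldr pmul (+ 1 ∷ []) l))
  (trans (Listₚ.map-upTo (λ i → linear (a (suc i))) (suc m)) (sym (Listₚ.map-applyUpTo (a ∘ suc) linear (suc m))))

doubleRoot-annihilates : ∀ m b x a → charPoly b (2 ℕ.+ m) ≡ factoredPoly a (2 ℕ.+ m) →
  (∀ n → 2 ℕ.+ m ≤ n → x n ≡ sumTo (λ i → b i * x (n ∸ i)) (2 ℕ.+ m)) →
  ∀ n → act (linear (a 1)) (act (linear (a 1)) (act (prodLinear (applyUpTo (λ i → a (2 ℕ.+ i)) m)) x)) n ≡ + 0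
doubleRoot-annihilates m b x a cp rec n = begin
  act (linear (a 1)) (act (linear (a 1)) (act Q x)) n
    ≡⟨ act-cong (linear (a 1)) (λ j → sym (act-pmul (linear (a 1)) Q x j)) n ⟩
  act (linear (a 1)) (act (pmul (linear (a 1)) Q) x) n
    ≡⟨ sym (act-pmul (linear (a 1)) (pmul (linear (a 1)) Q) x n) ⟩
  act (pmul (linear (a 1)) (pmul (linear (a 1)) Q)) x n
    ≡⟨ cong (λ q → act q x n) (sym (trans cp (factoredPoly≡ a m))) ⟩
  act (charPoly b (2 ℕ.+ m)) x n
    ≡⟨ act-charPoly (2 ℕ.+ m) b x rec n ⟩
  + 0 ∎
  where
  open ≡-Reasoning
  Q = prodLinear (applyUpTo (λ i → a (2 ℕ.+ i)) m)

FirstOneAt : ℕ → (ℕ → ℤ) → Set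
FirstOneAt m g = (∀ i → i < m → g i ≡ + 0) × g m ≡ + 1

prodLinear-FirstOneAt : ∀ hs m g → FirstOneAt (m ℕ.+ length hs) g → FirstOneAt m (act (prodLinear hs) g)
prodLinear-FirstOneAt [] m g (zeros , one) =
  (λ i i<m → trans (act-one g i) (zeros i (ℕₚ.<-≤-trans i<m (ℕₚ.m≤m+n m 0)))) ,
  trans (act-one g m) (subst (λ j → g j ≡ + 1) (ℕₚ.+-identityʳ m) one)
prodLinear-FirstOneAt (h ∷ hs) m g first
  with zeros , one ← prodLinear-FirstOneAt hs (suc m) g (subst (λ j → FirstOneAt j g) (ℕₚ.+-suc m (length hs)) first) =
  (λ i i<m → trans (act-prodLinear-∷ h hs g i)
                   (trans (cong₂ (λ u v → u - h * v) (zeros (suc i) (s≤s i<m)) (zeros i (ℕₚ.m<n⇒m<1+n i<m))) (lemma₀ h))) ,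
  trans (act-prodLinear-∷ h hs g m) (trans (cong₂ (λ u v → u - h * v) one (zeros m (ℕₚ.n<1+n m))) (lemma₁ h))
  where
  lemma₀ : ∀ h → + 0 - h * + 0 ≡ + 0
  lemma₀ = solve-∀
  lemma₁ : ∀ h → + 1 - h * + 0 ≡ + 1
  lemma₁ = solve-∀

expSum : List (ℤ × ℤ) → ℕ → ℤ
expSum []            n = + 0
expSum ((e , b) ∷ L) n = e * b ^ n + expSum L n

scaleCoeffs : ℤ → List (ℤ × ℤ) → List (ℤ × ℤ)
scaleCoeffs k = map (map₁ (k *_))

expSum-scale : ∀ k L n → expSum (scaleCoeffs k L) n ≡ k * expSum L n
expSum-scale k []            n = sym (ℤₚ.*-zeroʳ k)
expSum-scale k ((e , b) ∷ L) n =
  trans (cong (_+_ (k * e * b ^ n)) (expSum-scale k L n)) (lemma k e (b ^ n) (expSum L n))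
  where
  lemma : ∀ k e x s → k * e * x + k * s ≡ k * (e * x + s)
  lemma = solve-∀

gapProduct : ℤ → List (ℤ × ℤ) → ℤ
gapProduct h []            = + 1
gapProduct h ((e , b) ∷ L) = (b - h) * gapProduct h L

-- The terms e bⁿ / (b - h), which solve s (n + 1) - h s n = e bⁿ, times gapProduct h L to clear denominators.
antidiff : ℤ → List (ℤ × ℤ) → List (ℤ × ℤ)
antidiff h []            = []
antidiff h ((e , b) ∷ L) = (e * gapProduct h L , b) ∷ scaleCoeffs (b - h) (antidiff h L)

antidiff-spec : ∀ h L n →
  expSum (antidiff h L) (suc n) ≡ gapProduct h L * expSum L n + h * expSum (antidiff h L) n
antidiff-spec h []            n = lemma h
  where
  lemma : ∀ h → + 0 ≡ + 1 * + 0 + h * + 0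
  lemma = solve-∀
antidiff-spec h ((e , b) ∷ L) n = begin
  e * π * (b * b ^ n) + expSum (scaleCoeffs (b - h) S) (suc n)
    ≡⟨ cong (_+_ (e * π * (b * b ^ n)))
            (trans (expSum-scale (b - h) S (suc n)) (cong ((b - h) *_) (antidiff-spec h L n))) ⟩
  e * π * (b * b ^ n) + (b - h) * (π * expSum L n + h * expSum S n)
    ≡⟨ lemma e π b h (b ^ n) (expSum L n) (expSum S n) ⟩
  (b - h) * π * (e * b ^ n + expSum L n) + h * (e * π * b ^ n + (b - h) * expSum S n)
    ≡⟨ cong (λ z → (b - h) * π * (e * b ^ n + expSum L n) + h * (e * π * b ^ n + z))
            (sym (expSum-scale (b - h) S n)) ⟩
  (b - h) * π * (e * b ^ n + expSum L n) + h * (e * π * b ^ n + expSum (scaleCoeffs (b - h) S) n) ∎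
  where
  open ≡-Reasoning
  π = gapProduct h L
  S = antidiff h L
  lemma : ∀ e π b h x t s →
    e * π * (b * x) + (b - h) * (π * t + h * s) ≡ (b - h) * π * (e * x + t) + h * (e * π * x + (b - h) * s)
  lemma = solve-∀

antidiff-bases : ∀ {Q : ℤ → Set} h L → All (Q ∘ proj₂) L → All (Q ∘ proj₂) (antidiff h L)
antidiff-bases h []            []       = []
antidiff-bases h ((e , b) ∷ L) (q ∷ qs) = q ∷ Allₚ.map⁺ (antidiff-bases h L qs)

record ClosedForm (a : ℤ) (g : ℕ → ℤ) (D c d : ℤ) (L : List (ℤ × ℤ)) : Set where
  constructor closedForm
  field
    equation : ∀ n → D * g n ≡ (c + d * + n) * a ^ n + expSum L n

ClosedForm-cong : ∀ {a g g′ D c d L} → (∀ n → g n ≡ g′ n) → ClosedForm a g D c d L → ClosedForm a g′ D c d L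
ClosedForm-cong {D = D} g≗g′ (closedForm form) = closedForm λ n → trans (cong (D *_) (sym (g≗g′ n))) (form n)

-- (c′ + d′ n) aⁿ / (D (a - h)² π) solves w (n + 1) - h w n = (c + d n) aⁿ / D,
-- and the new term E hⁿ fits the initial value w 0.
ClosedForm-peel : ∀ {a h w D c d L} → ClosedForm a (λ n → w (suc n) - h * w n) D c d L →
  let Δ = a - h; π = gapProduct h L in
  Σ ℤ λ E → ClosedForm a w (D * (Δ * Δ) * π) ((c * Δ - d * a) * π) (d * Δ * π)
                         ((E , h) ∷ scaleCoeffs (Δ * Δ) (antidiff h L))
ClosedForm-peel {a} {h} {w} {D} {c} {d} {L} (closedForm form) = E , closedForm form′
  where
  Δ π D′ c′ d′ E : ℤ
  Δ  = a - h
  π  = gapProduct h L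
  D′ = D * (Δ * Δ) * π
  c′ = (c * Δ - d * a) * π
  d′ = d * Δ * π
  S L₀ : List (ℤ × ℤ)
  S  = antidiff h L
  L₀ = scaleCoeffs (Δ * Δ) S
  E  = D′ * w 0 - c′ - expSum L₀ 0
  form′ : ∀ n → D′ * w n ≡ (c′ + d′ * + n) * a ^ n + expSum ((E , h) ∷ L₀) n
  form′ zero = initial D′ (w 0) c′ d′ (expSum L₀ 0)
    where
    initial : ∀ D w c d s → D * w ≡ (c + d * + 0) * + 1 + ((D * w - c - s) * + 1 + s)
    initial = solve-∀
  form′ (suc n) = begin
    D′ * w (suc n)
      ≡⟨ split D Δ π (w (suc n)) (w n) h ⟩
    Δ * Δ * π * (D * (w (suc n) - h * w n)) + h * (D′ * w n)
      ≡⟨ cong₂ (λ u v → Δ * Δ * π * u + h * v) (form n) (form′ n) ⟩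
    Δ * Δ * π * ((c + d * + n) * a ^ n + expSum L n) + h * ((c′ + d′ * + n) * a ^ n + (E * h ^ n + expSum L₀ n))
      ≡⟨ cong (λ z → Δ * Δ * π * ((c + d * + n) * a ^ n + expSum L n) + h * ((c′ + d′ * + n) * a ^ n + (E * h ^ n + z)))
              (expSum-scale (Δ * Δ) S n) ⟩
    Δ * Δ * π * ((c + d * + n) * a ^ n + expSum L n) + h * ((c′ + d′ * + n) * a ^ n + (E * h ^ n + Δ * Δ * expSum S n))
      ≡⟨ regroup c d (+ n) a (a ^ n) h E (h ^ n) π (expSum L n) (expSum S n) ⟩
    (c′ + d′ * + suc n) * a ^ suc n + (E * h ^ suc n + Δ * Δ * (π * expSum L n + h * expSum S n))
      ≡⟨ cong (λ z → (c′ + d′ * + suc n) * a ^ suc n + (E * h ^ suc n + z))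
              (trans (cong (Δ * Δ *_) (sym (antidiff-spec h L n))) (sym (expSum-scale (Δ * Δ) S (suc n)))) ⟩
    (c′ + d′ * + suc n) * a ^ suc n + expSum ((E , h) ∷ L₀) (suc n) ∎
    where
    open ≡-Reasoning
    split : ∀ D Δ π w₁ w₀ h → D * (Δ * Δ) * π * w₁ ≡ Δ * Δ * π * (D * (w₁ - h * w₀)) + h * (D * (Δ * Δ) * π * w₀)
    split = solve-∀
    regroup : ∀ c d n a x h E y π t s →
      (a - h) * (a - h) * π * ((c + d * n) * x + t)
        + h * (((c * (a - h) - d * a) * π + d * (a - h) * π * n) * x + (E * y + (a - h) * (a - h) * s))
      ≡ ((c * (a - h) - d * a) * π + d * (a - h) * π * (+ 1 + n)) * (a * x)
        + (E * (h * y) + (a - h) * (a - h) * (π * t + h * s))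
    regroup = solve-∀

doubleRoot-ClosedForm : ∀ {a Y} → (∀ n → act (linear a) (act (linear a) Y) n ≡ + 0) →
                        FirstOneAt 1 Y → ClosedForm a Y a (+ 0) (+ 1) []
doubleRoot-ClosedForm {a} {Y} annihilated (zeros , one) = closedForm form
  where
  Z : ℕ → ℤ
  Z = act (linear a) Y
  Z≡aⁿ : ∀ n → Z n ≡ a ^ n
  Z≡aⁿ zero    = trans (act-linear a Y 0) (trans (cong₂ (λ u v → u - a * v) one (zeros 0 (s≤s z≤n))) (lemma a))
    where
    lemma : ∀ a → + 1 - a * + 0 ≡ + 1
    lemma = solve-∀
  Z≡aⁿ (suc n) = begin
    Z (suc n)  ≡⟨ ℤₚ.i-j≡0⇒i≡j _ _ (trans (sym (act-linear a Z n)) (annihilated n)) ⟩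
    a * Z n    ≡⟨ cong (a *_) (Z≡aⁿ n) ⟩
    a ^ suc n  ∎
    where open ≡-Reasoning
  form : ∀ n → a * Y n ≡ (+ 0 + + 1 * + n) * a ^ n + expSum [] n
  form zero    = trans (cong (a *_) (zeros 0 (s≤s z≤n))) (lemma a)
    where
    lemma : ∀ a → a * + 0 ≡ (+ 0 + + 1 * + 0) * + 1 + + 0
    lemma = solve-∀
  form (suc n) = begin
    a * Y (suc n)                                   ≡⟨ cong (a *_) (lemma₁ (Y (suc n)) (a * Y n)) ⟩
    a * (Y (suc n) - a * Y n + a * Y n)
      ≡⟨ cong₂ (λ u v → a * (u + v)) (trans (sym (act-linear a Y n)) (Z≡aⁿ n)) (form n) ⟩
    a * (a ^ n + ((+ 0 + + 1 * + n) * a ^ n + + 0)) ≡⟨ lemma₂ a (a ^ n) (+ n) ⟩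
    (+ 0 + + 1 * + suc n) * a ^ suc n + + 0         ∎
    where
    open ≡-Reasoning
    lemma₁ : ∀ u v → u ≡ u - v + v
    lemma₁ = solve-∀
    lemma₂ : ∀ a x n → a * (x + ((+ 0 + + 1 * n) * x + + 0)) ≡ (+ 0 + + 1 * (+ 1 + n)) * (a * x) + + 0
    lemma₂ = solve-∀

*-pres-∣ₛ : ∀ {a b x y} → a ∣ₛ x → b ∣ₛ y → a * b ∣ₛ x * y
*-pres-∣ₛ {a} {b} (divides q refl) (divides r refl) = divides (q * r) (lemma q a r b)
  where
  lemma : ∀ q a r b → q * a * (r * b) ≡ q * r * (a * b)
  lemma = solve-∀

x-1∣xⁿ-1 : ∀ x n → x - + 1 ∣ₛ x ^ n - + 1
x-1∣xⁿ-1 x zero    = divides (+ 0) refl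
x-1∣xⁿ-1 x (suc n) = begin
  x - + 1                         ∣⟨ ∣m∣n⇒∣m+n (∣n⇒∣m*n x (x-1∣xⁿ-1 x n)) ∣-refl ⟩
  x * (x ^ n - + 1) + (x - + 1)   ≡⟨ lemma x (x ^ n) ⟩
  x * x ^ n - + 1                 ∎
  where
  open ∣-Reasoning
  lemma : ∀ x y → x * (y - + 1) + (x - + 1) ≡ x * y - + 1
  lemma = solve-∀

[x-1]²∣xⁿ-1-n[x-1] : ∀ x n → (x - + 1) * (x - + 1) ∣ₛ x ^ n - + 1 - + n * (x - + 1)
[x-1]²∣xⁿ-1-n[x-1] x zero    = divides (+ 0) (lemma x)
  where
  lemma : ∀ x → + 1 - + 1 - + 0 * (x - + 1) ≡ + 0 * ((x - + 1) * (x - + 1))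
  lemma = solve-∀
[x-1]²∣xⁿ-1-n[x-1] x (suc n) = begin
  (x - + 1) * (x - + 1)
    ∣⟨ ∣m∣n⇒∣m+n (∣n⇒∣m*n x ([x-1]²∣xⁿ-1-n[x-1] x n)) (∣n⇒∣m*n (+ n) ∣-refl) ⟩
  x * (x ^ n - + 1 - + n * (x - + 1)) + + n * ((x - + 1) * (x - + 1))
    ≡⟨ lemma x (x ^ n) (+ n) ⟩
  x * x ^ n - + 1 - (+ 1 + + n) * (x - + 1) ∎
  where
  open ∣-Reasoning
  lemma : ∀ x y n → x * (y - + 1 - n * (x - + 1)) + n * ((x - + 1) * (x - + 1)) ≡ x * y - + 1 - (+ 1 + n) * (x - + 1)
  lemma = solve-∀

pos-^ : ∀ m n → + (m ℕ.^ n) ≡ (+ m) ^ n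
pos-^ m zero    = refl
pos-^ m (suc n) = trans (ℤₚ.pos-* m (m ℕ.^ n)) (cong (+ m *_) (pos-^ m n))

n<m^n : ∀ {m} → 1 < m → ∀ n → n < m ℕ.^ n
n<m^n 1<m zero    = s≤s z≤n
n<m^n {m} 1<m (suc n) = begin-strict
  suc n                         <⟨ ℕₚ.+-mono-≤ (ℕₚ.m^n>0 m {{ℕ.>-nonZero (ℕₚ.<⇒≤ 1<m)}} n) (n<m^n 1<m n) ⟩
  m ℕ.^ n ℕ.+ m ℕ.^ n           ≡⟨ cong (m ℕ.^ n ℕ.+_) (sym (ℕₚ.+-identityʳ (m ℕ.^ n))) ⟩
  2 ℕ.* m ℕ.^ n                 ≤⟨ ℕₚ.*-monoˡ-≤ (m ℕ.^ n) 1<m ⟩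
  m ℕ.* m ℕ.^ n                 ∎
  where open ℕₚ.≤-Reasoning

factor∣prodTo : ∀ f {i} n → 1 ≤ i → i ≤ n → f i ∣ₛ prodTo f n
factor∣prodTo f {suc i} zero (s≤s _) ()
factor∣prodTo f (suc n) 1≤i i≤1+n with ℕₚ.m≤n⇒m<n∨m≡n i≤1+n
... | inj₁ i<1+n = ∣m⇒∣m*n (f (suc n)) (factor∣prodTo f n 1≤i (ℕₚ.≤-pred i<1+n))
... | inj₂ refl  = ∣n⇒∣m*n (prodTo f n) ∣-refl

module AtPrime {p : ℕ} (p-prime : Prime p) where

  P : ℤ
  P = + p

  instance
    p-nonTrivial : ℕ.NonTrivial p
    p-nonTrivial = prime⇒nonTrivial p-prime
    p-nonZero : ℕ.NonZero p
    p-nonZero = ℕ.nonTrivial⇒nonZero p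

  P^-nonZero : ∀ M → ℤ.NonZero (P ^ M)
  P^-nonZero M = ℤ.≢-nonZero (ℕ.≢-nonZero⁻¹ p ∘ cong ∣_∣ ∘ ℤₚ.i^n≡0⇒i≡0 P M)

  pred[p]<p : ℕ.pred p < p
  pred[p]<p = ℕₚ.m≤pred[n]⇒suc[m]≤n ℕₚ.≤-refl

  Unit : ℤ → Set
  Unit z = ¬ (P ∣ₛ z)

  Separated : ℤ → ℤ → Set
  Separated u v = Unit (u - v)

  euclid : ∀ {a b} → P ∣ₛ a * b → P ∣ₛ a ⊎ P ∣ₛ b
  euclid {a} {b} P∣ab with euclidsLemma ∣ a ∣ ∣ b ∣ p-prime (subst (p ℕ∣.∣_) (ℤₚ.abs-* a b) (∣⇒∣ᵤ P∣ab))
  ... | inj₁ p∣a = inj₁ (∣ᵤ⇒∣ p∣a)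
  ... | inj₂ p∣b = inj₂ (∣ᵤ⇒∣ p∣b)

  unit-* : ∀ {a b} → Unit a → Unit b → Unit (a * b)
  unit-* a-unit b-unit = [ a-unit , b-unit ]′ ∘ euclid

  unit-pos : ∀ {n} → 0 < n → n < p → Unit (+ n)
  unit-pos 0<n n<p P∣n = ℕₚ.<⇒≱ n<p (ℕ∣.∣⇒≤ {{ℕ.>-nonZero 0<n}} (∣⇒∣ᵤ P∣n))

  unit-1 : Unit (+ 1)
  unit-1 = unit-pos (s≤s z≤n) (ℕ.nonTrivial⇒n>1 p)

  unit-^ : ∀ {a} → Unit a → ∀ n → Unit (a ^ n)
  unit-^ a-unit zero    = unit-1
  unit-^ a-unit (suc n) = unit-* a-unit (unit-^ a-unit n)

  unit-! : ∀ {n} → n < p → Unit (+ (n !))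
  unit-! {zero}  _   = unit-1
  unit-! {suc n} n<p = subst Unit (sym (ℤₚ.pos-* (suc n) (n !)))
                             (unit-* (unit-pos (s≤s z≤n) n<p) (unit-! (ℕₚ.<-trans (ℕₚ.n<1+n n) n<p)))

  P^-mono : ∀ {e M} → e ≤ M → P ^ e ∣ₛ P ^ M
  P^-mono {e} {M} e≤M = divides (P ^ (M ∸ e)) (begin
    P ^ M               ≡⟨ cong (P ^_) (sym (ℕₚ.m∸n+n≡m e≤M)) ⟩
    P ^ (M ∸ e ℕ.+ e)   ≡⟨ ℤₚ.^-distribˡ-+-* P (M ∸ e) e ⟩
    P ^ (M ∸ e) * P ^ e ∎)
    where open ≡-Reasoning

  unit-cancel : ∀ {D z} M → Unit D → P ^ M ∣ₛ D * z → P ^ M ∣ₛ z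
  unit-cancel {z = z} zero D-unit _ = divides z (sym (ℤₚ.*-identityʳ z))
  unit-cancel {D} (suc M) D-unit P^[1+M]∣Dz
    with divides q refl ← unit-cancel M D-unit (∣-trans (P^-mono (ℕₚ.n≤1+n M)) P^[1+M]∣Dz) =
    [ ⊥-elim ∘ D-unit , (λ P∣q → *-pres-∣ₛ P∣q (∣-refl {P ^ M})) ]′ (euclid P∣Dq)
    where
    P∣Dq : P ∣ₛ D * q
    P∣Dq = *-cancelʳ-∣ (P ^ M) {{P^-nonZero M}} (subst (P ^ suc M ∣ₛ_) (sym (ℤₚ.*-assoc D q (P ^ M))) P^[1+M]∣Dz)

  same-residue⇒∣ : ∀ {x y} → x %ℕ p ≡ y %ℕ p → P ∣ₛ x - y
  same-residue⇒∣ {x} {y} eq = divides (x /ℕ p - y /ℕ p) (begin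
    x - y
      ≡⟨ cong₂ _-_ (a≡a%ℕn+[a/ℕn]*n x p) (a≡a%ℕn+[a/ℕn]*n y p) ⟩
    (+ (x %ℕ p) + x /ℕ p * P) - (+ (y %ℕ p) + y /ℕ p * P)
      ≡⟨ cong (λ r → (+ r + x /ℕ p * P) - (+ (y %ℕ p) + y /ℕ p * P)) eq ⟩
    (+ (y %ℕ p) + x /ℕ p * P) - (+ (y %ℕ p) + y /ℕ p * P)
      ≡⟨ lemma (+ (y %ℕ p)) (x /ℕ p) (y /ℕ p) P ⟩
    (x /ℕ p - y /ℕ p) * P ∎)
    where
    open ≡-Reasoning
    lemma : ∀ r s t P → (r + s * P) - (r + t * P) ≡ (s - t) * P
    lemma = solve-∀

  -- pigeonhole on the p - 1 nonzero residues of a⁰, …, aᵖ⁻¹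
  unit-order : ∀ {a} → Unit a → Σ ℕ λ d → 0 < d × d < p × P ∣ₛ a ^ d - + 1
  unit-order {a} a-unit = collision (pigeonhole pred[p]<p predResidue)
    where
    residue : ℕ → ℕ
    residue n = a ^ n %ℕ p
    residue-nonZero : ∀ n → ℕ.NonZero (residue n)
    residue-nonZero n = ℕ.≢-nonZero λ r≡0 → unit-^ a-unit n (divides (a ^ n /ℕ p)
      (trans (a≡a%ℕn+[a/ℕn]*n (a ^ n) p) (trans (cong (λ r → + r + a ^ n /ℕ p * P) r≡0) (ℤₚ.+-identityˡ _))))
    residue-pred< : ∀ n → ℕ.pred (residue n) < ℕ.pred p
    residue-pred< n = ℕₚ.pred-mono-< {{residue-nonZero n}} (n%ℕd<d (a ^ n) p)
    predResidue : Fin p → Fin (ℕ.pred p)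
    predResidue i = fromℕ< (residue-pred< (toℕ i))
    collision : Σ (Fin p) (λ i → Σ (Fin p) λ j → toℕ i < toℕ j × predResidue i ≡ predResidue j) →
                Σ ℕ λ d → 0 < d × d < p × P ∣ₛ a ^ d - + 1
    collision (i , j , i<j , same) =
      d , ℕₚ.m<n⇒0<n∸m i<j , ℕₚ.≤-<-trans (ℕₚ.m∸n≤m (toℕ j) (toℕ i)) (toℕ<n j) ,
      [ ⊥-elim ∘ unit-^ a-unit (toℕ i) , id ]′ (euclid P∣aⁱ[aᵈ-1])
      where
      d : ℕ
      d = toℕ j ∸ toℕ i
      P∣aⁱ[aᵈ-1] : P ∣ₛ a ^ toℕ i * (a ^ d - + 1)
      P∣aⁱ[aᵈ-1] = begin
        P                              ∣⟨ same-residue⇒∣ {a ^ toℕ j} {a ^ toℕ i} same-residue ⟩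
        a ^ toℕ j - a ^ toℕ i           ≡⟨ cong (λ n → a ^ n - a ^ toℕ i) (sym (ℕₚ.m+[n∸m]≡n (ℕₚ.<⇒≤ i<j))) ⟩
        a ^ (toℕ i ℕ.+ d) - a ^ toℕ i   ≡⟨ cong (_- a ^ toℕ i) (ℤₚ.^-distribˡ-+-* a (toℕ i) d) ⟩
        a ^ toℕ i * a ^ d - a ^ toℕ i   ≡⟨ lemma (a ^ toℕ i) (a ^ d) ⟩
        a ^ toℕ i * (a ^ d - + 1)       ∎
        where
        open ∣-Reasoning
        same-residue : residue (toℕ j) ≡ residue (toℕ i)
        same-residue = ℕₚ.pred-injective {{residue-nonZero (toℕ j)}} {{residue-nonZero (toℕ i)}}
          (trans (sym (toℕ-fromℕ< _)) (trans (cong toℕ (sym same)) (toℕ-fromℕ< _)))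
        lemma : ∀ x y → x * y - x ≡ x * (y - + 1)
        lemma = solve-∀

  P∣a^[p-1]!-1 : ∀ {a} → Unit a → P ∣ₛ a ^ (ℕ.pred p !) - + 1
  P∣a^[p-1]!-1 {a} a-unit = from-order (unit-order a-unit)
    where
    from-order : (Σ ℕ λ d → 0 < d × d < p × P ∣ₛ a ^ d - + 1) → P ∣ₛ a ^ (ℕ.pred p !) - + 1
    from-order (suc d , _ , 1+d<p , P∣a^[1+d]-1) = begin
      P                        ∣⟨ P∣a^[1+d]-1 ⟩
      a ^ suc d - + 1          ∣⟨ x-1∣xⁿ-1 (a ^ suc d) q ⟩
      (a ^ suc d) ^ q - + 1    ≡⟨ cong (_- + 1) (trans (ℤₚ.^-*-assoc a (suc d) q)
                                    (cong (a ^_) (trans (ℕₚ.*-comm (suc d) q) (sym (ℕ∣._∣_.equality 1+d∣[p-1]!))))) ⟩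
      a ^ (ℕ.pred p !) - + 1   ∎
      where
      open ∣-Reasoning
      1+d∣[p-1]! : suc d ℕ∣.∣ ℕ.pred p !
      1+d∣[p-1]! = ℕ∣.∣-trans (ℕ∣.m∣m*n (d !)) (ℕ∣.m≤n⇒m!∣n! (ℕₚ.<⇒≤pred 1+d<p))
      q : ℕ
      q = ℕ∣._∣_.quotient 1+d∣[p-1]!

  linear-congruence : ∀ {u} → Unit u → ∀ w → Σ ℕ λ l → P ∣ₛ w + + l * u
  linear-congruence {u} u-unit w = l , (begin
    P                                    ∣⟨ ∣m∣n⇒∣m+n (∣n⇒∣m*n (- w) P∣uv-1) (∣n⇒∣m*n (- (q * u)) ∣-refl) ⟩
    - w * (u * v - + 1) + - (q * u) * P  ≡⟨ lemma₁ w u v q P ⟩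
    w + (- (w * v) - q * P) * u          ≡⟨ cong (λ r → w + (r - q * P) * u) (a≡a%ℕn+[a/ℕn]*n (- (w * v)) p) ⟩
    w + (+ l + q * P - q * P) * u        ≡⟨ cong (λ r → w + r * u) (lemma₂ (+ l) (q * P)) ⟩
    w + + l * u                          ∎)
    where
    open ∣-Reasoning
    v = u ^ ℕ.pred (ℕ.pred p !)
    l = (- (w * v)) %ℕ p
    q = (- (w * v)) /ℕ p
    P∣uv-1 : P ∣ₛ u * v - + 1
    P∣uv-1 = subst (λ n → P ∣ₛ u ^ n - + 1) (sym (ℕₚ.suc-pred (ℕ.pred p !) {{ℕₚ._!≢0 (ℕ.pred p)}})) (P∣a^[p-1]!-1 u-unit)
    lemma₁ : ∀ w u v q P → - w * (u * v - + 1) + - (q * u) * P ≡ w + (- (w * v) - q * P) * u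
    lemma₁ = solve-∀
    lemma₂ : ∀ r s → r + s - s ≡ r
    lemma₂ = solve-∀

  lift-exponent : ∀ {x} j → P ^ suc j ∣ₛ x - + 1 → P ^ suc (suc j) ∣ₛ x ^ p - + 1
  lift-exponent {x} j P^[1+j]∣x-1 = begin
    P * P ^ suc j
      ∣⟨ ∣m∣n⇒∣m+n (*-monoʳ-∣ P P^[1+j]∣x-1)
                   (∣-trans (*-pres-∣ₛ P∣x-1 P^[1+j]∣x-1) ([x-1]²∣xⁿ-1-n[x-1] x p)) ⟩
    P * (x - + 1) + (x ^ p - + 1 - P * (x - + 1))
      ≡⟨ lemma (P * (x - + 1)) (x ^ p) ⟩
    x ^ p - + 1 ∎
    where
    open ∣-Reasoning
    P∣x-1 : P ∣ₛ x - + 1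
    P∣x-1 = ∣-trans (∣m⇒∣m*n (P ^ j) ∣-refl) P^[1+j]∣x-1
    lemma : ∀ y z → y + (z - + 1 - y) ≡ z - + 1
    lemma = solve-∀

  P^[1+j]∣x^[p^j]-1 : ∀ {x} → P ∣ₛ x - + 1 → ∀ j → P ^ suc j ∣ₛ x ^ (p ℕ.^ j) - + 1
  P^[1+j]∣x^[p^j]-1 {x} P∣x-1 zero = begin
    P * + 1       ≡⟨ ℤₚ.*-identityʳ P ⟩
    P             ∣⟨ P∣x-1 ⟩
    x - + 1       ≡⟨ cong (_- + 1) (sym (ℤₚ.*-identityʳ x)) ⟩
    x * + 1 - + 1 ∎
    where open ∣-Reasoning
  P^[1+j]∣x^[p^j]-1 {x} P∣x-1 (suc j) = begin
    P ^ suc (suc j)             ∣⟨ lift-exponent j (P^[1+j]∣x^[p^j]-1 P∣x-1 j) ⟩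
    (x ^ (p ℕ.^ j)) ^ p - + 1   ≡⟨ cong (_- + 1) (trans (ℤₚ.^-*-assoc x (p ℕ.^ j) p)
                                                        (cong (x ^_) (ℕₚ.*-comm (p ℕ.^ j) p))) ⟩
    x ^ (p ℕ.^ suc j) - + 1     ∎
    where open ∣-Reasoning

  powers-periodic : ∀ {b} N → P ∣ₛ b ^ N - + 1 →
    ∀ t l j → P ^ suc j ∣ₛ b ^ (N ℕ.* (t ℕ.+ l ℕ.* p ℕ.^ j)) - b ^ (N ℕ.* t)
  powers-periodic {b} N P∣bᴺ-1 t l j = begin
    P ^ suc j                 ∣⟨ ∣n⇒∣m*n (b ^ (N ℕ.* t)) (∣-trans (P^[1+j]∣x^[p^j]-1 P∣bᴺ-1 j) (x-1∣xⁿ-1 X l)) ⟩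
    b ^ (N ℕ.* t) * (X ^ l - + 1)   ≡⟨ lemma (b ^ (N ℕ.* t)) (X ^ l) ⟩
    b ^ (N ℕ.* t) * X ^ l - b ^ (N ℕ.* t) ≡⟨ cong (_- b ^ (N ℕ.* t)) (sym split) ⟩
    b ^ (N ℕ.* (t ℕ.+ l ℕ.* p ℕ.^ j)) - b ^ (N ℕ.* t) ∎
    where
    open ∣-Reasoning
    X = (b ^ N) ^ (p ℕ.^ j)
    lemma : ∀ y z → y * (z - + 1) ≡ y * z - y
    lemma = solve-∀
    split : b ^ (N ℕ.* (t ℕ.+ l ℕ.* p ℕ.^ j)) ≡ b ^ (N ℕ.* t) * X ^ l
    split = begin-equality
      b ^ (N ℕ.* (t ℕ.+ l ℕ.* p ℕ.^ j))          ≡⟨ cong (b ^_) (ℕₚ.*-distribˡ-+ N t (l ℕ.* p ℕ.^ j)) ⟩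
      b ^ (N ℕ.* t ℕ.+ N ℕ.* (l ℕ.* p ℕ.^ j))    ≡⟨ ℤₚ.^-distribˡ-+-* b (N ℕ.* t) _ ⟩
      b ^ (N ℕ.* t) * b ^ (N ℕ.* (l ℕ.* p ℕ.^ j)) ≡⟨ cong (λ n → b ^ (N ℕ.* t) * b ^ (N ℕ.* n)) (ℕₚ.*-comm l (p ℕ.^ j)) ⟩
      b ^ (N ℕ.* t) * b ^ (N ℕ.* (p ℕ.^ j ℕ.* l)) ≡⟨ cong (b ^ (N ℕ.* t) *_) (sym (trans (ℤₚ.^-*-assoc (b ^ N) (p ℕ.^ j) l)
                                                        (ℤₚ.^-*-assoc b N (p ℕ.^ j ℕ.* l)))) ⟩
      b ^ (N ℕ.* t) * X ^ l                       ∎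

  expSum-periodic : ∀ {N} L → All (λ eb → P ∣ₛ proj₂ eb ^ N - + 1) L →
    ∀ t l j → P ^ suc j ∣ₛ expSum L (N ℕ.* (t ℕ.+ l ℕ.* p ℕ.^ j)) - expSum L (N ℕ.* t)
  expSum-periodic []            []               t l j = divides (+ 0) refl
  expSum-periodic {N} ((e , b) ∷ L) (P∣bᴺ-1 ∷ rest) t l j = begin
    P ^ suc j
      ∣⟨ ∣m∣n⇒∣m+n (∣n⇒∣m*n e (powers-periodic N P∣bᴺ-1 t l j)) (expSum-periodic {N} L rest t l j) ⟩
    e * (b ^ n′ - b ^ n) + (expSum L n′ - expSum L n)
      ≡⟨ lemma e (b ^ n′) (b ^ n) (expSum L n′) (expSum L n) ⟩
    e * b ^ n′ + expSum L n′ - (e * b ^ n + expSum L n) ∎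
    where
    open ∣-Reasoning
    n′ = N ℕ.* (t ℕ.+ l ℕ.* p ℕ.^ j)
    n  = N ℕ.* t
    lemma : ∀ e x y s r → e * (x - y) + (s - r) ≡ e * x + s - (e * y + r)
    lemma = solve-∀

  -- Every base b has bᴺ ≡ 1 (mod p), so each bᴺᵗ has period pʲ in t modulo pʲ⁺¹;
  -- only the factor d n of the double root breaks this periodicity.
  closedForm-increment : ∀ {a x D c d L} N → ClosedForm a x D c d L →
    P ∣ₛ a ^ N - + 1 → All (λ eb → P ∣ₛ proj₂ eb ^ N - + 1) L →
    ∀ t l j → P ^ suc j ∣ₛ D * x (N ℕ.* (t ℕ.+ l ℕ.* p ℕ.^ j)) - D * x (N ℕ.* t) - + l * P ^ j * (d * + N)
  closedForm-increment {a} {x} {D} {c} {d} {L} N (closedForm form) P∣aᴺ-1 bases t l j = begin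
    P ^ suc j
      ∣⟨ ∣m∣n⇒∣m+n (∣m∣n⇒∣m+n (∣n⇒∣m*n (c + d * + n) (powers-periodic N P∣aᴺ-1 t l j))
                              (∣n⇒∣m*n (d * + N * + l) (*-pres-∣ₛ P∣A′-1 (∣-refl {P ^ j}))))
                   (expSum-periodic {N} L bases t l j) ⟩
    (c + d * + n) * (a ^ n′ - a ^ n) + d * + N * + l * ((a ^ n′ - + 1) * P ^ j) + (expSum L n′ - expSum L n)
      ≡⟨ lemma c d (+ n) (+ N) (+ l) (P ^ j) (a ^ n′) (a ^ n) (expSum L n′) (expSum L n) ⟩
    (c + d * (+ n + + N * + l * P ^ j)) * a ^ n′ + expSum L n′ - ((c + d * + n) * a ^ n + expSum L n) - + l * P ^ j * (d * + N)
      ≡⟨ cong (λ m → (c + d * m) * a ^ n′ + expSum L n′ - ((c + d * + n) * a ^ n + expSum L n) - + l * P ^ j * (d * + N))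
              (sym index) ⟩
    (c + d * + n′) * a ^ n′ + expSum L n′ - ((c + d * + n) * a ^ n + expSum L n) - + l * P ^ j * (d * + N)
      ≡⟨ cong₂ (λ u v → u - v - + l * P ^ j * (d * + N)) (sym (form n′)) (sym (form n)) ⟩
    D * x n′ - D * x n - + l * P ^ j * (d * + N) ∎
    where
    open ∣-Reasoning
    n′ = N ℕ.* (t ℕ.+ l ℕ.* p ℕ.^ j)
    n  = N ℕ.* t
    P∣A′-1 : P ∣ₛ a ^ n′ - + 1
    P∣A′-1 = subst (λ z → P ∣ₛ z - + 1) (ℤₚ.^-*-assoc a N _) (∣-trans P∣aᴺ-1 (x-1∣xⁿ-1 (a ^ N) (t ℕ.+ l ℕ.* p ℕ.^ j)))
    index : + n′ ≡ + n + + N * + l * P ^ j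
    index = begin-equality
      + n′                               ≡⟨ ℤₚ.pos-* N _ ⟩
      + N * (+ t + + (l ℕ.* p ℕ.^ j))    ≡⟨ cong (λ z → + N * (+ t + z)) (trans (ℤₚ.pos-* l _) (cong (+ l *_) (pos-^ p j))) ⟩
      + N * (+ t + + l * P ^ j)          ≡⟨ lemma′ (+ N) (+ t) (+ l) (P ^ j) ⟩
      + N * + t + + N * + l * P ^ j      ≡⟨ cong (_+ + N * + l * P ^ j) (sym (ℤₚ.pos-* N t)) ⟩
      + n + + N * + l * P ^ j            ∎
      where
      lemma′ : ∀ N t l Q → N * (t + l * Q) ≡ N * t + N * l * Q
      lemma′ = solve-∀
    lemma : ∀ c d n N l Q x y s r →
      (c + d * n) * (x - y) + d * N * l * ((x - + 1) * Q) + (s - r)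
        ≡ (c + d * (n + N * l * Q)) * x + s - ((c + d * n) * y + r) - l * Q * (d * N)
    lemma = solve-∀

  HitsEveryResidue : (ℕ → ℤ) → Set
  HitsEveryResidue f = ∀ M z → Σ ℕ λ t → P ^ M ∣ₛ f t - z

  unitSlope⇒HitsEveryResidue : ∀ (f : ℕ → ℤ) {u} → Unit u →
    (∀ t l j → P ^ suc j ∣ₛ f (t ℕ.+ l ℕ.* p ℕ.^ j) - f t - + l * P ^ j * u) →
    HitsEveryResidue f
  unitSlope⇒HitsEveryResidue f u-unit step zero    T = 0 , divides (f 0 - T) (sym (ℤₚ.*-identityʳ _))
  unitSlope⇒HitsEveryResidue f {u} u-unit step (suc M) T = lift (unitSlope⇒HitsEveryResidue f u-unit step M T)
    where
    lift : (Σ ℕ λ t → P ^ M ∣ₛ f t - T) → Σ ℕ λ t → P ^ suc M ∣ₛ f t - T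
    lift (t , divides w fₜ-T≡wPᴹ) = t′ , (begin
      P * P ^ M                                            ∣⟨ ∣m∣n⇒∣m+n (step t l M) (*-pres-∣ₛ P∣w+lu (∣-refl {P ^ M})) ⟩
      f t′ - f t - + l * P ^ M * u + (w + + l * u) * P ^ M ≡⟨ lemma₁ (f t′) (f t) (+ l) (P ^ M) u w ⟩
      f t′ - f t + w * P ^ M                               ≡⟨ cong (λ z → f t′ - f t + z) (sym fₜ-T≡wPᴹ) ⟩
      f t′ - f t + (f t - T)                               ≡⟨ lemma₂ (f t′) (f t) T ⟩
      f t′ - T                                             ∎)
      where
      open ∣-Reasoning
      l : ℕ
      l = proj₁ (linear-congruence u-unit w)
      P∣w+lu : P ∣ₛ w + + l * u
      P∣w+lu = proj₂ (linear-congruence u-unit w)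
      t′ = t ℕ.+ l ℕ.* p ℕ.^ M
      lemma₁ : ∀ y x l Q u w → y - x - l * Q * u + (w + l * u) * Q ≡ y - x + w * Q
      lemma₁ = solve-∀
      lemma₂ : ∀ y x T → y - x + (x - T) ≡ y - T
      lemma₂ = solve-∀

  record UnitClosedForm (a : ℤ) (g : ℕ → ℤ) : Set where
    field
      D c d      : ℤ
      L          : List (ℤ × ℤ)
      D-unit     : Unit D
      d-unit     : Unit d
      bases-unit : All (Unit ∘ proj₂) L
      closed     : ClosedForm a g D c d L

  gapProduct-unit : ∀ h L → All (λ eb → Separated (proj₂ eb) h) L → Unit (gapProduct h L)
  gapProduct-unit h []            []            = unit-1
  gapProduct-unit h ((e , b) ∷ L) (b-h ∷ L-sep) = unit-* b-h (gapProduct-unit h L L-sep)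

  peel-prodLinear : ∀ hs {a g D c d L} → All Unit hs → AllPairs Separated (a ∷ hs) → Unit D → Unit d →
    All (λ eb → Unit (proj₂ eb) × All (Separated (proj₂ eb)) hs) L →
    ClosedForm a (act (prodLinear hs) g) D c d L → UnitClosedForm a g
  peel-prodLinear [] {g = g} {D} {c} {d} {L} [] _ D-unit d-unit L-ok form = record
    { D = D ; c = c ; d = d ; L = L ; D-unit = D-unit ; d-unit = d-unit
    ; bases-unit = All.map proj₁ L-ok ; closed = ClosedForm-cong (act-one g) form }
  peel-prodLinear (h ∷ hs) {a} {g} {L = L} (h-unit ∷ hs-unit) ((a-h ∷ a-hs) ∷ h-hs ∷ hs-sep) D-unit d-unit L-ok form =
    peel-prodLinear hs hs-unit (a-hs ∷ hs-sep) (unit-* (unit-* D-unit (unit-* a-h a-h)) π-unit) (unit-* (unit-* d-unit a-h) π-unit)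
      ((h-unit , h-hs) ∷ Allₚ.map⁺ (antidiff-bases h L (All.map (λ { (b-unit , _ ∷ b-hs) → b-unit , b-hs }) L-ok)))
      (proj₂ (ClosedForm-peel (ClosedForm-cong (act-prodLinear-∷ h hs g) form)))
    where
    π-unit : Unit (gapProduct h L)
    π-unit = gapProduct-unit h L (All.map (λ { (_ , b-h ∷ _) → b-h }) L-ok)

  UnitClosedForm⇒HitsEveryResidue : ∀ {a x} → Unit a → UnitClosedForm a x → HitsEveryResidue x
  UnitClosedForm⇒HitsEveryResidue {a} {x} a-unit cf M z =
    N ℕ.* proj₁ solution , unit-cancel M D-unit (subst (P ^ M ∣ₛ_) (factor D (x (N ℕ.* proj₁ solution)) z) (proj₂ solution))
    where
    open UnitClosedForm cf
    N = ℕ.pred p !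
    solution : Σ ℕ λ t → P ^ M ∣ₛ D * x (N ℕ.* t) - D * z
    solution = unitSlope⇒HitsEveryResidue (λ t → D * x (N ℕ.* t)) (unit-* d-unit (unit-! pred[p]<p))
      (closedForm-increment N closed (P∣a^[p-1]!-1 a-unit) (All.map P∣a^[p-1]!-1 bases-unit)) M (D * z)
    factor : ∀ D y z → D * y - D * z ≡ D * (y - z)
    factor = solve-∀

  HitsEveryResidue⇒QuotientSetDense : ∀ x → HitsEveryResidue x → QuotientSetDenseInQp p x
  HitsEveryResidue⇒QuotientSetDense x dense r s s≢0 N = m , n , xₙ≢0 , close
    where
    B M : ℕ
    B = ∣ s ∣ ℕ.* ∣ s ∣
    M = B ℕ.+ N
    n = proj₁ (dense M s)
    m = proj₁ (dense M r)
    P^M∣xₙ-s : P ^ M ∣ₛ x n - s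
    P^M∣xₙ-s = proj₂ (dense M s)
    P^M∣xₘ-r : P ^ M ∣ₛ x m - r
    P^M∣xₘ-r = proj₂ (dense M r)
    s²-bound : ∀ e → P ^ e ∣ₛ s * s → e < B
    s²-bound e P^e∣s² = ℕₚ.<-≤-trans (n<m^n (ℕ.nonTrivial⇒n>1 p) e) (ℕ∣.∣⇒≤ {{B-nonZero}} p^e∣B)
      where
      B-nonZero : ℕ.NonZero B
      B-nonZero = ℕₚ.m*n≢0 ∣ s ∣ ∣ s ∣ {{ℤ.≢-nonZero s≢0}} {{ℤ.≢-nonZero s≢0}}
      p^e∣B : p ℕ.^ e ℕ∣.∣ B
      p^e∣B = subst₂ ℕ∣._∣_ (cong ∣_∣ (sym (pos-^ p e))) (ℤₚ.abs-* s s) (∣⇒∣ᵤ P^e∣s²)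
    s²-divisible : ∀ {e} → e ≤ M → P ^ e ∣ₛ x n * s → P ^ e ∣ₛ s * s
    s²-divisible {e} e≤M P^e∣xₙs = begin
      P ^ e                   ∣⟨ ∣m∣n⇒∣m-n P^e∣xₙs (∣m⇒∣m*n s (∣-trans (P^-mono e≤M) P^M∣xₙ-s)) ⟩
      x n * s - (x n - s) * s ≡⟨ lemma (x n) s ⟩
      s * s                   ∎
      where
      open ∣-Reasoning
      lemma : ∀ y s → y * s - (y - s) * s ≡ s * s
      lemma = solve-∀
    valuation-bound : ∀ e → P ^ e ∣ₛ x n * s → e < B
    valuation-bound e P^e∣xₙs with e ℕₚ.≤? M
    ... | yes e≤M = s²-bound e (s²-divisible e≤M P^e∣xₙs)
    ... | no  e≰M = ⊥-elim (ℕₚ.<⇒≱ (s²-bound M (s²-divisible ℕₚ.≤-refl P^M∣xₙs)) (ℕₚ.m≤m+n B N))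
      where
      P^M∣xₙs : P ^ M ∣ₛ x n * s
      P^M∣xₙs = ∣-trans (P^-mono (ℕₚ.<⇒≤ (ℕₚ.≰⇒> e≰M))) P^e∣xₙs
    xₙ≢0 : x n ≢ + 0
    xₙ≢0 xₙ≡0 = ℕₚ.<⇒≱ (valuation-bound M (subst (λ y → P ^ M ∣ₛ y * s) (sym xₙ≡0) (divides (+ 0) refl)))
                       (ℕₚ.m≤m+n B N)
    close : PAdicClose p N (x m) (x n) r s
    close e p^e∣xₙs = ∣⇒∣ᵤ (begin
      P ^ (e ℕ.+ N)                   ∣⟨ P^-mono (ℕₚ.+-monoˡ-≤ N (ℕₚ.<⇒≤ (valuation-bound e (∣ᵤ⇒∣ p^e∣xₙs)))) ⟩
      P ^ M                           ∣⟨ ∣m∣n⇒∣m+n (∣n⇒∣m*n s P^M∣xₘ-r) (∣n⇒∣m*n (- r) P^M∣xₙ-s) ⟩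
      s * (x m - r) + - r * (x n - s) ≡⟨ lemma (x m) (x n) r s ⟩
      x m * s - r * x n               ∎)
      where
      open ∣-Reasoning
      lemma : ∀ u v r s → s * (u - r) + - r * (v - s) ≡ u * s - r * v
      lemma = solve-∀

theorem1p2 :
    (k : ℕ) → 3 ≤ k →
    (b : ℕ → ℤ) → b k ≢ + 0 →
    (x : ℕ → ℤ) →
    (∀ n → k ≤ n → x n ≡ sumTo (λ i → b i * x (n ∸ i)) k) →
    (∀ i → i < k ∸ 1 → x i ≡ + 0) →
    x (k ∸ 1) ≡ + 1 →
    (a : ℕ → ℤ) →
    charPoly b k ≡ factoredPoly a k →
    (∀ i j → 1 ≤ i → i ≤ k ∸ 1 → 1 ≤ j → j ≤ k ∸ 1 → i ≢ j → a i ≢ a j) →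
    (p : ℕ) → Prime p →
    ¬ ((+ p) ∣ prodTo a (k ∸ 1)) →
    (∀ i j → 1 ≤ i → i ≤ k ∸ 1 → 1 ≤ j → j ≤ k ∸ 1 → i ≢ j → ¬ ((+ p) ∣ (a i - a j))) →
    QuotientSetDenseInQp p x
theorem1p2 (suc (suc (suc k₀))) (s≤s (s≤s (s≤s z≤n))) b _ x rec zeros one a cp _ p p-prime prod-unit gaps-unit =
  HitsEveryResidue⇒QuotientSetDense x (UnitClosedForm⇒HitsEveryResidue (All.head roots-unit) x-closed)
  where
  open AtPrime p-prime
  m = suc k₀
  hs = applyUpTo (λ i → a (2 ℕ.+ i)) m
  roots-unit : All Unit (a 1 ∷ hs)
  roots-unit = Allₚ.applyUpTo⁺₁ (a ∘ suc) (suc m)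
    (λ i<k-1 P∣aᵢ → prod-unit (∣⇒∣ᵤ (∣-trans P∣aᵢ (factor∣prodTo a (suc m) (s≤s z≤n) i<k-1))))
  roots-separated : AllPairs Separated (a 1 ∷ hs)
  roots-separated = AllPairsₚ.applyUpTo⁺₁ (a ∘ suc) (suc m)
    (λ i<j j<k-1 → gaps-unit _ _ (s≤s z≤n) (ℕₚ.<-trans i<j j<k-1) (s≤s z≤n) j<k-1
                             (ℕₚ.<⇒≢ i<j ∘ ℕₚ.suc-injective) ∘ ∣⇒∣ᵤ)
  Y-closed : ClosedForm (a 1) (act (prodLinear hs) x) (a 1) (+ 0) (+ 1) []
  Y-closed = doubleRoot-ClosedForm (doubleRoot-annihilates m b x a cp rec) (prodLinear-FirstOneAt hs 1 x x-starts)
    where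
    x-starts : FirstOneAt (1 ℕ.+ length hs) x
    x-starts = subst (λ j → FirstOneAt j x) (cong suc (sym (Listₚ.length-applyUpTo (λ i → a (2 ℕ.+ i)) m))) (zeros , one)
  x-closed : UnitClosedForm (a 1) x
  x-closed = peel-prodLinear hs (All.tail roots-unit) roots-separated (All.head roots-unit) unit-1 [] Y-closed
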